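{- Let $G$ be a simple graph on $n$ vertices, with $e(G)$ edges, and let $D_i(G)$ be the number of vertices of degree $i$ in $G$. Then $$\nu(G)\ge \max_{1\le q<n}\frac{e(G)-\sum_{i\ge q} i\cdot D_i(G)}{q}.$$
   Context: $\nu(G)$ denotes the matching number (maximum size of a matching) of $G$. -}

module Defs where

open import Data.Nat using (ℕ; _+_; _*_; _≤ᵇ_; _<ᵇ_; _≡ᵇ_)
open import Data.Bool using (Bool; true; false; if_then_else_; _∧_)
open import Data.Fin using (Fin; toℕ)
open import Data.Nat.ListAction using (sum)
open import Data.List using (List; []; _∷_; map; allFin; upTo; length; concatMap)
open import Data.List.Relation.Unary.All using (All)
open import Data.List.Relation.Unary.Unique.Propositional using (Unique)
open import Data.Product using (_×_; _,_; proj₁; proj₂)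
open import Relation.Binary.PropositionalEquality using (_≡_)

record Graph (n : ℕ) : Set where
  field
    adj   : Fin n → Fin n → Bool
    sym   : ∀ i j → adj i j ≡ adj j i
    irrefl : ∀ i → adj i i ≡ false
open Graph public

countFin : ∀ {n} → (Fin n → Bool) → ℕ
countFin {n} p = sum (map (λ i → if p i then 1 else 0) (allFin n))

deg : ∀ {n} → Graph n → Fin n → ℕ
deg G v = countFin (adj G v)

numEdges : ∀ {n} → Graph n → ℕ
numEdges {n} G = sum (map (λ i → countFin (λ j → adj G i j ∧ (toℕ i <ᵇ toℕ j))) (allFin n))

D : ∀ {n} → Graph n → ℕ → ℕ
D G i = countFin (λ v → deg G v ≡ᵇ i)

-- Σ_{i ≥ q} i · D_i(G)   (degrees are < n, so i ranges over q ≤ i < n)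
highDegSum : ∀ {n} → Graph n → ℕ → ℕ
highDegSum {n} G q = sum (map (λ i → if q ≤ᵇ i then i * D G i else 0) (upTo n))

-- A matching: a list of edges whose endpoints are pairwise distinct
-- (in particular the edges are pairwise disjoint and distinct).
endpoints : ∀ {n} → List (Fin n × Fin n) → List (Fin n)
endpoints = concatMap (λ e → proj₁ e ∷ proj₂ e ∷ [])

record IsMatching {n} (G : Graph n) (M : List (Fin n × Fin n)) : Set where
  field
    edges    : All (λ e → adj G (proj₁ e) (proj₂ e) ≡ true) M
    disjoint : Unique (endpoints M)

record IsMatchingNumber {n} (G : Graph n) (k : ℕ) : Set where
  field
    witness    : List (Fin n × Fin n)
    isMatching : IsMatching G witness
    size       : length witness ≡ k
    maximal    : ∀ M → IsMatching G M → length M Data.Nat.≤ k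

-- Let H be the subgraph induced by the vertices of degree less than q. Every edge outside H has
-- an endpoint of degree at least q, so 2e(G) ≤ 2e(H) + 2 Σ_{i ≥ q} i·D_i(G), and ν(H) ≤ ν(G).
-- It remains to show e(H) ≤ ν(H)(Δ(H) + 1) where Δ(H) ≤ q − 1; matchings are measured by the
-- number of vertices they cover, twice their size. This goes by induction on the number of edges.
-- If a non-isolated vertex v is covered by every maximum matching, then ν(G − v) = ν(G) − 1 while
-- at most Δ edges are lost. Otherwise, by Gallai's lemma (proved with alternating paths), two
-- vertices missed by a maximum matching lie in different components. So either at most one
-- non-isolated vertex is missed, hence there are s ≤ 2ν + 1 non-isolated vertices and
-- 2e ≤ min(sΔ, s(s − 1)) ≤ 2ν(Δ + 1), or G splits into two closed parts, both with edges, and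
-- induction applies to each. Maximum matchings and components are obtained under double
-- negation, which is harmless since the conclusion is a decidable inequality.

module Submission where

open import Defs hiding (sym)

open import Data.Bool using (Bool; true; false; if_then_else_; not; _∧_; T) renaming (_≟_ to _≟ᵇ_)
open import Data.Bool.Properties using (∧-comm; ∧-zeroʳ; not-involutive; not-injective)
open import Data.Empty using (⊥)
open import Data.Fin using (Fin; zero; suc; toℕ; _≟_)
open import Data.Fin.Properties using (suc-injective; pigeonhole)
open import Data.List using (List; []; _∷_; length; map; tabulate; allFin; upTo)
open import Data.List.Properties using (map-tabulate; map-cong)
open import Data.List.Membership.Propositional using (_∈_)
open import Data.List.Membership.Propositional.Properties using (∈-upTo⁺)
open import Data.List.Relation.Unary.All as All using (All)
import Data.List.Relation.Unary.AllPairs as AllPairs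
open import Data.List.Relation.Unary.Any using (here; there)
open import Data.Maybe as Maybe using (Maybe; just; nothing; is-just)
open import Data.Maybe.Properties using (just-injective) renaming (≡-dec to ≡-dec-Maybe)
open import Data.Nat using (ℕ; zero; suc; pred; _+_; _*_; _≤_; _<_; _≤?_; _<ᵇ_; _≤ᵇ_; _≡ᵇ_; z≤n; s≤s)
open import Data.Nat.Induction using (<-rec)
import Data.Nat.ListAction as List
open import Data.Nat.Properties hiding (_≟_; suc-injective)
open import Algebra.Properties.Semiring.Sum +-*-semiring
  using (sum; sum-syntax; sum-cong-≗; ∑-distrib-+; ∑-comm; *-distribʳ-sum; sum-replicate-zero)
open import Data.Nat.Solver using (module +-*-Solver)
open import Data.Product using (Σ; ∃; ∃₂; ∃-syntax; _×_; _,_; proj₁; proj₂)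
open import Data.Sum using (_⊎_; inj₁; inj₂)
open import Data.Unit using (tt)
open import Effect.Monad using (RawMonad)
open import Function using (_∘_; case_of_)
open import Function.Bundles using (mk⇔)
open import Level using (0ℓ)
open import Relation.Binary.Construct.Closure.ReflexiveTransitive using (Star; ε; _◅_; _◅◅_)
open import Relation.Binary.PropositionalEquality
open import Relation.Nullary using (¬_; Dec; yes; no; does; contradiction)
open import Relation.Nullary.Decidable using (dec-true; dec-false; does-⇔; ¬¬-excluded-middle; decidable-stable)
open import Relation.Nullary.Negation using (¬¬-Monad)
open import Relation.Unary using (Decidable)

open RawMonad {f = 0ℓ} ¬¬-Monad using (pure; _>>=_)
open +-*-Solver using (solve; _:=_; _:+_; _:*_; con)

-- Finite sums and counting

∑-mono-≤ : ∀ {n} {f g : Fin n → ℕ} → (∀ i → f i ≤ g i) → sum f ≤ sum g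
∑-mono-≤ {zero}  f≤g = z≤n
∑-mono-≤ {suc n} f≤g = +-mono-≤ (f≤g zero) (∑-mono-≤ (f≤g ∘ suc))

∑-mono-< : ∀ {n} {f g : Fin n → ℕ} a → (∀ i → f i ≤ g i) → f a < g a → sum f < sum g
∑-mono-< zero    f≤g fa<ga = +-mono-<-≤ fa<ga (∑-mono-≤ (f≤g ∘ suc))
∑-mono-< (suc a) f≤g fa<ga = +-mono-≤-< (f≤g zero) (∑-mono-< a (f≤g ∘ suc) fa<ga)

term≤∑ : ∀ {n} (f : Fin n → ℕ) a → f a ≤ sum f
term≤∑ f zero    = m≤m+n _ _
term≤∑ f (suc a) = ≤-trans (term≤∑ (f ∘ suc) a) (m≤n+m _ _)

∑-zero : ∀ {n} {f : Fin n → ℕ} → (∀ i → f i ≡ 0) → sum f ≡ 0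
∑-zero {n} f≡0 = trans (sum-cong-≗ f≡0) (sum-replicate-zero n)

𝟙 : Bool → ℕ
𝟙 b = if b then 1 else 0

𝟙≤1 : ∀ b → 𝟙 b ≤ 1
𝟙≤1 true  = ≤-refl
𝟙≤1 false = z≤n

count : ∀ {n} → (Fin n → Bool) → ℕ
count {n} p = ∑[ i < n ] 𝟙 (p i)

count≤n : ∀ {n} (p : Fin n → Bool) → count p ≤ n
count≤n {zero}  p = z≤n
count≤n {suc n} p = +-mono-≤ (𝟙≤1 (p zero)) (count≤n (p ∘ suc))

count-mono : ∀ {n} {p q : Fin n → Bool} → (∀ i → p i ≡ true → q i ≡ true) → count p ≤ count q
count-mono {p = p} {q} p⊆q = ∑-mono-≤ pointwise
  where
  pointwise : ∀ i → 𝟙 (p i) ≤ 𝟙 (q i)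
  pointwise i with p i | p⊆q i
  ... | false | _ = z≤n
  ... | true  | q≡ rewrite q≡ refl = ≤-refl

member⇒1≤count : ∀ {n} (p : Fin n → Bool) {a} → p a ≡ true → 1 ≤ count p
member⇒1≤count p {a} pa = ≤-trans (≤-reflexive (cong 𝟙 (sym pa))) (term≤∑ (𝟙 ∘ p) a)

1≤count⇒member : ∀ {n} (p : Fin n → Bool) → 1 ≤ count p → ∃ λ a → p a ≡ true
1≤count⇒member {suc n} p 1≤c with p zero in p0
... | true  = zero , p0
... | false with 1≤count⇒member (p ∘ suc) 1≤c
...   | a , pa = suc a , pa

2≤count⇒two-members : ∀ {n} (p : Fin n → Bool) → 2 ≤ count p →
  ∃₂ λ a b → a ≢ b × p a ≡ true × p b ≡ true
2≤count⇒two-members {suc n} p 2≤c with p zero in p0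
... | true with 1≤count⇒member (p ∘ suc) (≤-pred 2≤c)
...   | b , pb = zero , suc b , (λ ()) , p0 , pb
2≤count⇒two-members {suc n} p 2≤c | false with 2≤count⇒two-members (p ∘ suc) 2≤c
...   | a , b , a≢b , pa , pb = suc a , suc b , a≢b ∘ suc-injective , pa , pb

∑-point : ∀ {n} (f : Fin n → ℕ) a → (∀ i → i ≢ a → f i ≡ 0) → sum f ≡ f a
∑-point f zero    f≡0 = trans (cong (f zero +_) (∑-zero (λ i → f≡0 (suc i) λ ()))) (+-identityʳ _)
∑-point f (suc a) f≡0 = trans (cong (_+ sum (f ∘ suc)) (f≡0 zero λ ()))
  (∑-point (f ∘ suc) a (λ i i≢a → f≡0 (suc i) (i≢a ∘ suc-injective)))

count-singleton : ∀ {n} (a : Fin n) → count (λ i → does (i ≟ a)) ≡ 1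
count-singleton a = trans (∑-point _ a (λ i i≢a → cong 𝟙 (dec-false (i ≟ a) i≢a))) (cong 𝟙 (dec-true (a ≟ a) refl))

∑-distrib-+₃ : ∀ {n} (f g h : Fin n → ℕ) → ∑[ i < n ] (f i + g i + h i) ≡ sum f + sum g + sum h
∑-distrib-+₃ f g h = trans (∑-distrib-+ (λ i → f i + g i) h) (cong (_+ sum h) (∑-distrib-+ f g))

δ : ∀ {n} → Fin n → Fin n → ℕ
δ a i = 𝟙 (does (i ≟ a))

∑-δ* : ∀ {n} (a : Fin n) x → ∑[ i < n ] (δ a i * x) ≡ x
∑-δ* a x = trans (sym (*-distribʳ-sum x (δ a))) (trans (cong (_* x) (count-singleton a)) (*-identityˡ x))

∑-update₂ : ∀ {n} (f g : Fin n → ℕ) {a b} → a ≢ b → (∀ i → i ≢ a → i ≢ b → f i ≡ g i) →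
  sum f + g a + g b ≡ sum g + f a + f b
∑-update₂ {n} f g {a} {b} a≢b agree = begin
  sum f + g a + g b
    ≡⟨ cong₂ (λ s t → sum f + s + t) (∑-δ* a (g a)) (∑-δ* b (g b)) ⟨
  sum f + ∑[ i < n ] (δ a i * g a) + ∑[ i < n ] (δ b i * g b)
    ≡⟨ ∑-distrib-+₃ f (λ i → δ a i * g a) (λ i → δ b i * g b) ⟨
  ∑[ i < n ] (f i + δ a i * g a + δ b i * g b)
    ≡⟨ sum-cong-≗ pointwise ⟩
  ∑[ i < n ] (g i + δ a i * f a + δ b i * f b)
    ≡⟨ ∑-distrib-+₃ g (λ i → δ a i * f a) (λ i → δ b i * f b) ⟩
  sum g + ∑[ i < n ] (δ a i * f a) + ∑[ i < n ] (δ b i * f b)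
    ≡⟨ cong₂ (λ s t → sum g + s + t) (∑-δ* a (f a)) (∑-δ* b (f b)) ⟩
  sum g + f a + f b ∎
  where
  open ≡-Reasoning
  exchangeˡ : ∀ x y → x + (y + 0) + 0 ≡ y + (x + 0) + 0
  exchangeˡ = solve 2 (λ x y → x :+ (y :+ con 0) :+ con 0 := y :+ (x :+ con 0) :+ con 0) refl
  exchangeʳ : ∀ x y → x + 0 + (y + 0) ≡ y + 0 + (x + 0)
  exchangeʳ = solve 2 (λ x y → x :+ con 0 :+ (y :+ con 0) := y :+ con 0 :+ (x :+ con 0)) refl
  pointwise : ∀ i → f i + δ a i * g a + δ b i * g b ≡ g i + δ a i * f a + δ b i * f b
  pointwise i with i ≟ a | i ≟ b
  ... | yes refl | yes refl = contradiction refl a≢b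
  ... | yes refl | no _     = exchangeˡ (f i) (g i)
  ... | no _     | yes refl = exchangeʳ (f i) (g i)
  ... | no i≢a   | no i≢b   = cong (λ t → t + 0 + 0) (agree i i≢a i≢b)

count-∧ʳ : ∀ {n} (p : Fin n → Bool) c → count (λ i → p i ∧ c) ≡ 𝟙 c * count p
count-∧ʳ {n} p c = begin
  ∑[ i < n ] 𝟙 (p i ∧ c)     ≡⟨ sum-cong-≗ (λ i → 𝟙-∧ (p i) c) ⟩
  ∑[ i < n ] (𝟙 (p i) * 𝟙 c) ≡⟨ *-distribʳ-sum (𝟙 c) (𝟙 ∘ p) ⟨
  count p * 𝟙 c              ≡⟨ *-comm (count p) (𝟙 c) ⟩
  𝟙 c * count p              ∎
  where
  open ≡-Reasoning
  𝟙-∧ : ∀ x y → 𝟙 (x ∧ y) ≡ 𝟙 x * 𝟙 y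
  𝟙-∧ true  true  = refl
  𝟙-∧ true  false = refl
  𝟙-∧ false _     = refl

∧-true : ∀ {x y} → x ∧ y ≡ true → x ≡ true × y ≡ true
∧-true {true} {true} _ = refl , refl

does⇒witness : ∀ {A : Set} (a? : Dec A) → does a? ≡ true → A
does⇒witness (yes a) _ = a

true⇒T : ∀ {b} → b ≡ true → T b
true⇒T refl = tt

T⇒≡true : ∀ {b} → T b → b ≡ true
T⇒≡true {true} _ = refl

¬¬-decidable : ∀ {n} (P : Fin n → Set) → ¬ ¬ Decidable P
¬¬-decidable {zero}  P = pure λ ()
¬¬-decidable {suc n} P = do
  P₀? ← ¬¬-excluded-middle
  Pₛ? ← ¬¬-decidable (P ∘ suc)
  pure λ { zero → P₀? ; (suc a) → Pₛ? a }

-- Graphs, degrees and degree sums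

Adjacent : ∀ {n} → Graph n → Fin n → Fin n → Set
Adjacent G a b = adj G a b ≡ true

adjacent-sym : ∀ {n} (G : Graph n) {a b} → Adjacent G a b → Adjacent G b a
adjacent-sym G {a} {b} e = trans (Graph.sym G b a) e

adjacent⇒≢ : ∀ {n} (G : Graph n) {a b} → Adjacent G a b → a ≢ b
adjacent⇒≢ G {a} e refl with trans (sym e) (irrefl G a)
... | ()

degree : ∀ {n} → Graph n → Fin n → ℕ
degree G v = count (adj G v)

degreeSum : ∀ {n} → Graph n → ℕ
degreeSum {n} G = ∑[ v < n ] degree G v

adjacent⇒1≤degree : ∀ {n} (G : Graph n) {a b} → Adjacent G a b → 1 ≤ degree G a
adjacent⇒1≤degree G e = member⇒1≤count (adj G _) e

degree<count : ∀ {n} (G : Graph n) (p : Fin n → Bool) {a} →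
  (∀ b → Adjacent G a b → p b ≡ true) → p a ≡ true → degree G a < count p
degree<count {n} G p {a} nbrs pa = begin
  suc (degree G a)                                   ≡⟨ +-comm 1 (degree G a) ⟩
  degree G a + 1                                     ≡⟨ cong (degree G a +_) (count-singleton a) ⟨
  degree G a + count (λ b → does (b ≟ a))            ≡⟨ ∑-distrib-+ (𝟙 ∘ adj G a) (δ a) ⟨
  ∑[ b < n ] (𝟙 (adj G a b) + 𝟙 (does (b ≟ a)))     ≤⟨ ∑-mono-≤ pointwise ⟩
  count p                                            ∎
  where
  open ≤-Reasoning
  pointwise : ∀ b → 𝟙 (adj G a b) + 𝟙 (does (b ≟ a)) ≤ 𝟙 (p b)
  pointwise b with b ≟ a | adj G a b in ab
  ... | yes refl | true  = contradiction refl (adjacent⇒≢ G ab)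
  ... | yes refl | false = ≤-reflexive (cong 𝟙 (sym pa))
  ... | no _     | true  = ≤-reflexive (cong 𝟙 (sym (nbrs b ab)))
  ... | no _     | false = z≤n

degree<n : ∀ {n} (G : Graph n) a → degree G a < n
degree<n G a = ≤-trans (degree<count G (λ _ → true) (λ _ _ → refl) refl) (count≤n _)

induced : ∀ {n} → Graph n → (Fin n → Bool) → Graph n
induced G L = record
  { adj    = λ a b → adj G a b ∧ (L a ∧ L b)
  ; sym    = λ a b → cong₂ _∧_ (Graph.sym G a b) (∧-comm (L a) (L b))
  ; irrefl = λ a → cong (_∧ (L a ∧ L a)) (irrefl G a)
  }

induced-adjacent⇒ : ∀ {n} (G : Graph n) L {a b} → Adjacent (induced G L) a b →
  Adjacent G a b × L a ≡ true × L b ≡ true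
induced-adjacent⇒ G L {a} {b} e with adj G a b | L a | L b
... | true | true | true = refl , refl , refl

adjacent⇒induced : ∀ {n} (G : Graph n) L {a b} → Adjacent G a b → L a ≡ true → L b ≡ true →
  Adjacent (induced G L) a b
adjacent⇒induced G L e La Lb rewrite e | La | Lb = refl

degree-induced-≤ : ∀ {n} (G : Graph n) L v → degree (induced G L) v ≤ degree G v
degree-induced-≤ G L v = count-mono {p = adj (induced G L) v} (λ b e → proj₁ (induced-adjacent⇒ G L e))

degree-induced-outside : ∀ {n} (G : Graph n) L {v} → L v ≡ false → degree (induced G L) v ≡ 0
degree-induced-outside G L {v} Lv =
  ∑-zero (λ b → trans (cong (λ t → 𝟙 (adj G v b ∧ (t ∧ L b))) Lv) (cong 𝟙 (∧-zeroʳ (adj G v b))))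

degreeSumOutside : ∀ {n} → Graph n → (Fin n → Bool) → ℕ
degreeSumOutside {n} G L = ∑[ a < n ] (𝟙 (not (L a)) * degree G a)

degreeSum-induced : ∀ {n} (G : Graph n) L →
  degreeSum G ≤ degreeSum (induced G L) + 2 * degreeSumOutside G L
degreeSum-induced {n} G L = begin
  degreeSum G
    ≤⟨ ∑-mono-≤ (λ a → ∑-mono-≤ (λ b → pointwise (adj G a b) (L a) (L b))) ⟩
  ∑[ a < n ] ∑[ b < n ] (𝟙 (inside a b) + 𝟙 (leaves a b) + 𝟙 (enters a b))
    ≡⟨ sum-cong-≗ (λ a → ∑-distrib-+₃ (𝟙 ∘ inside a) (𝟙 ∘ leaves a) (𝟙 ∘ enters a)) ⟩
  ∑[ a < n ] (degree (induced G L) a + count (leaves a) + count (enters a))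
    ≡⟨ ∑-distrib-+₃ (degree (induced G L)) (count ∘ leaves) (count ∘ enters) ⟩
  degreeSum (induced G L) + ∑[ a < n ] count (leaves a) + ∑[ a < n ] count (enters a)
    ≡⟨ cong₂ (λ s t → degreeSum (induced G L) + s + t) leaving entering ⟩
  degreeSum (induced G L) + degreeSumOutside G L + degreeSumOutside G L
    ≡⟨ +-assoc (degreeSum (induced G L)) _ _ ⟩
  degreeSum (induced G L) + (degreeSumOutside G L + degreeSumOutside G L)
    ≡⟨ cong (degreeSum (induced G L) +_) (cong (degreeSumOutside G L +_) (+-identityʳ _)) ⟨
  degreeSum (induced G L) + 2 * degreeSumOutside G L ∎
  where
  open ≤-Reasoning
  inside leaves enters : Fin _ → Fin _ → Bool
  inside a b = adj G a b ∧ (L a ∧ L b)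
  leaves a b = adj G a b ∧ not (L a)
  enters a b = adj G a b ∧ not (L b)
  pointwise : ∀ x la lb → 𝟙 x ≤ 𝟙 (x ∧ (la ∧ lb)) + 𝟙 (x ∧ not la) + 𝟙 (x ∧ not lb)
  pointwise false _     _     = z≤n
  pointwise true  true  true  = ≤-refl
  pointwise true  true  false = s≤s z≤n
  pointwise true  false _     = s≤s z≤n
  leaving : ∑[ a < n ] count (leaves a) ≡ degreeSumOutside G L
  leaving = sum-cong-≗ (λ a → count-∧ʳ (adj G a) (not (L a)))
  entering : ∑[ a < n ] count (enters a) ≡ degreeSumOutside G L
  entering = begin-equality
    ∑[ a < n ] ∑[ b < n ] 𝟙 (enters a b)  ≡⟨ ∑-comm (λ a b → 𝟙 (enters a b)) ⟩
    ∑[ b < n ] ∑[ a < n ] 𝟙 (enters a b)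
      ≡⟨ sum-cong-≗ (λ b → trans (sum-cong-≗ (λ a → cong (λ t → 𝟙 (t ∧ not (L b))) (Graph.sym G a b)))
                                 (count-∧ʳ (adj G b) (not (L b)))) ⟩
    degreeSumOutside G L ∎

degreeSum-split : ∀ {n} (G : Graph n) C → (∀ {a b} → Adjacent G a b → C a ≡ C b) →
  degreeSum G ≡ degreeSum (induced G C) + degreeSum (induced G (not ∘ C))
degreeSum-split {n} G C closed = begin
  degreeSum G
    ≡⟨ sum-cong-≗ (λ a → trans (sum-cong-≗ (λ b → pointwise (adj G a b) (C a) (C b) closed))
                               (∑-distrib-+ (𝟙 ∘ adj (induced G C) a) (𝟙 ∘ adj (induced G (not ∘ C)) a))) ⟩
  ∑[ a < n ] (degree (induced G C) a + degree (induced G (not ∘ C)) a)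
    ≡⟨ ∑-distrib-+ (degree (induced G C)) (degree (induced G (not ∘ C))) ⟩
  degreeSum (induced G C) + degreeSum (induced G (not ∘ C)) ∎
  where
  open ≡-Reasoning
  pointwise : ∀ x c₁ c₂ → (x ≡ true → c₁ ≡ c₂) → 𝟙 x ≡ 𝟙 (x ∧ (c₁ ∧ c₂)) + 𝟙 (x ∧ (not c₁ ∧ not c₂))
  pointwise false _ _ _ = refl
  pointwise true c₁ c₂ c₁≡c₂ with c₁≡c₂ refl
  pointwise true true  .true  _ | refl = refl
  pointwise true false .false _ | refl = refl

except : ∀ {n} → Fin n → Fin n → Bool
except v a = not (does (a ≟ v))

_─_ : ∀ {n} → Graph n → Fin n → Graph n
G ─ v = induced G (except v)

except-self : ∀ {n} (v : Fin n) → except v v ≡ false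
except-self v = cong not (dec-true (v ≟ v) refl)

except-other : ∀ {n} {v a : Fin n} → a ≢ v → except v a ≡ true
except-other {v = v} {a} a≢v = cong not (dec-false (a ≟ v) a≢v)

degreeSum-─ : ∀ {n} (G : Graph n) v → degreeSum G ≤ degreeSum (G ─ v) + 2 * degree G v
degreeSum-─ G v = ≤-trans (degreeSum-induced G (except v)) (≤-reflexive (cong (λ t → degreeSum (G ─ v) + 2 * t) outside))
  where
  outside : degreeSumOutside G (except v) ≡ degree G v
  outside = trans (∑-point _ v (λ a a≢v → cong (λ t → 𝟙 (not t) * degree G a) (except-other a≢v)))
                  (trans (cong (λ t → 𝟙 (not t) * degree G v) (except-self v)) (+-identityʳ _))

degreeSum-─-< : ∀ {n} (G : Graph n) v → 1 ≤ degree G v → degreeSum (G ─ v) < degreeSum G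
degreeSum-─-< G v 1≤d = ∑-mono-< v (degree-induced-≤ G (except v))
  (≤-trans (≤-reflexive (cong suc (degree-induced-outside G (except v) (except-self v)))) 1≤d)

nonIsolated : ∀ {n} → Graph n → Fin n → Bool
nonIsolated G a = does (1 ≤? degree G a)

degreeSum≤nonIsolated* : ∀ {n} (G : Graph n) B → (∀ a → 1 ≤ degree G a → degree G a ≤ B) →
  degreeSum G ≤ count (nonIsolated G) * B
degreeSum≤nonIsolated* {n} G B degree≤B = begin
  degreeSum G                               ≤⟨ ∑-mono-≤ pointwise ⟩
  ∑[ a < n ] (𝟙 (nonIsolated G a) * B)     ≡⟨ *-distribʳ-sum B (𝟙 ∘ nonIsolated G) ⟨
  count (nonIsolated G) * B                 ∎
  where
  open ≤-Reasoning
  pointwise : ∀ a → degree G a ≤ 𝟙 (nonIsolated G a) * B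
  pointwise a with 1 ≤? degree G a
  ... | yes 1≤d = ≤-trans (degree≤B a 1≤d)
    (≤-reflexive (sym (trans (cong (λ t → 𝟙 t * B) (dec-true (1 ≤? degree G a) 1≤d)) (+-identityʳ B))))
  ... | no  1≰d = ≤-trans (≤-reflexive (n<1⇒n≡0 (≰⇒> 1≰d))) z≤n

degree<nonIsolated : ∀ {n} (G : Graph n) a → 1 ≤ degree G a → degree G a < count (nonIsolated G)
degree<nonIsolated G a 1≤d = degree<count G (nonIsolated G)
  (λ b ab → dec-true (1 ≤? degree G b) (adjacent⇒1≤degree G (adjacent-sym G ab)))
  (dec-true (1 ≤? degree G a) 1≤d)

-- Matchings

record Matching {n} (G : Graph n) : Set where
  field
    partner     : Fin n → Maybe (Fin n)
    partner-sym : ∀ {a b} → partner a ≡ just b → partner b ≡ just a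
    partner-adj : ∀ {a b} → partner a ≡ just b → Adjacent G a b
open Matching public

module _ {n} {G : Graph n} where

  matched : Matching G → Fin n → Bool
  matched M a = is-just (partner M a)

  covered : Matching G → ℕ
  covered M = count (matched M)

  IsMaximum : Matching G → Set
  IsMaximum M = ∀ (M′ : Matching G) → covered M′ ≤ covered M

  partner≢self : ∀ (M : Matching G) {a} → partner M a ≢ just a
  partner≢self M e = adjacent⇒≢ G (partner-adj M e) refl

  partner-unique : ∀ (M : Matching G) {a b c} → partner M a ≡ just c → partner M b ≡ just c → a ≡ b
  partner-unique M ac bc = just-injective (trans (sym (partner-sym M ac)) (partner-sym M bc))

  unmatched⇒free : ∀ (M : Matching G) {a} → matched M a ≡ false → partner M a ≡ nothing
  unmatched⇒free M {a} e with partner M a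
  ... | nothing = refl

  module _ (M M′ : Matching G) {a b} (a≢b : a ≢ b) (agree : ∀ i → i ≢ a → i ≢ b → matched M i ≡ matched M′ i) where

    private
      agree₂ : ∀ {p q p′ q′} → matched M a ≡ p → matched M b ≡ q → matched M′ a ≡ p′ → matched M′ b ≡ q′ →
        covered M + 𝟙 p′ + 𝟙 q′ ≡ covered M′ + 𝟙 p + 𝟙 q
      agree₂ refl refl refl refl =
        ∑-update₂ (𝟙 ∘ matched M) (𝟙 ∘ matched M′) a≢b (λ i i≢a i≢b → cong 𝟙 (agree i i≢a i≢b))

    covered-+2 : matched M a ≡ false → matched M b ≡ false → matched M′ a ≡ true → matched M′ b ≡ true →
      covered M′ ≡ covered M + 2
    covered-+2 Ma Mb M′a M′b = sym (begin
      covered M + 2          ≡⟨ +-assoc (covered M) 1 1 ⟨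
      covered M + 1 + 1      ≡⟨ agree₂ Ma Mb M′a M′b ⟩
      covered M′ + 0 + 0     ≡⟨ trans (+-identityʳ _) (+-identityʳ _) ⟩
      covered M′             ∎)
      where open ≡-Reasoning

    covered-exchange : matched M a ≡ false → matched M b ≡ true → matched M′ a ≡ true → matched M′ b ≡ false →
      covered M ≡ covered M′
    covered-exchange Ma Mb M′a M′b = +-cancelʳ-≡ 1 _ _ (begin
      covered M + 1          ≡⟨ +-identityʳ _ ⟨
      covered M + 1 + 0      ≡⟨ agree₂ Ma Mb M′a M′b ⟩
      covered M′ + 0 + 1     ≡⟨ cong (_+ 1) (+-identityʳ _) ⟩
      covered M′ + 1         ∎)
      where open ≡-Reasoning

  module Rewire (M : Matching G) (a b : Fin n) (x y : Maybe (Fin n)) where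

    rewired : Fin n → Maybe (Fin n)
    rewired c with c ≟ a | c ≟ b
    ... | yes _ | _     = x
    ... | no _  | yes _ = y
    ... | no _  | no _  = partner M c

    rewired-a : rewired a ≡ x
    rewired-a with a ≟ a
    ... | yes _  = refl
    ... | no a≢a = contradiction refl a≢a

    rewired-b : a ≢ b → rewired b ≡ y
    rewired-b a≢b with b ≟ a | b ≟ b
    ... | yes b≡a | _      = contradiction (sym b≡a) a≢b
    ... | no _    | yes _  = refl
    ... | no _    | no b≢b = contradiction refl b≢b

    rewired-other : ∀ {c} → c ≢ a → c ≢ b → rewired c ≡ partner M c
    rewired-other {c} c≢a c≢b with c ≟ a | c ≟ b
    ... | yes c≡a | _       = contradiction c≡a c≢a
    ... | no _    | yes c≡b = contradiction c≡b c≢b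
    ... | no _    | no _    = refl

  augment : (M : Matching G) → ∀ {a b} → partner M a ≡ nothing → partner M b ≡ nothing → Adjacent G a b →
    Σ (Matching G) λ M′ → covered M′ ≡ covered M + 2
  augment M {a} {b} a-free b-free ab = M′ , covered-+2 M M′ a≢b agree (cong is-just a-free) (cong is-just b-free)
    (cong is-just rewired-a) (cong is-just (rewired-b a≢b))
    where
    open Rewire M a b (just b) (just a)
    a≢b : a ≢ b
    a≢b = adjacent⇒≢ G ab
    unpaired : ∀ {c d} → partner M c ≡ just d → d ≢ a × d ≢ b
    unpaired cd = (λ { refl → contradiction (trans (sym a-free) (partner-sym M cd)) λ () })
                , (λ { refl → contradiction (trans (sym b-free) (partner-sym M cd)) λ () })
    sym′ : ∀ {c d} → rewired c ≡ just d → rewired d ≡ just c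
    sym′ {c} cd with c ≟ a | c ≟ b
    ... | yes refl | _        rewrite just-injective (sym cd) = rewired-b a≢b
    ... | no _     | yes refl rewrite just-injective (sym cd) = rewired-a
    ... | no _     | no _     = let d≢a , d≢b = unpaired cd in trans (rewired-other d≢a d≢b) (partner-sym M cd)
    adj′ : ∀ {c d} → rewired c ≡ just d → Adjacent G c d
    adj′ {c} cd with c ≟ a | c ≟ b
    ... | yes refl | _        rewrite just-injective (sym cd) = ab
    ... | no _     | yes refl rewrite just-injective (sym cd) = adjacent-sym G ab
    ... | no _     | no _     = partner-adj M cd
    M′ : Matching G
    M′ = record { partner = rewired ; partner-sym = sym′ ; partner-adj = adj′ }
    agree : ∀ i → i ≢ a → i ≢ b → matched M i ≡ matched M′ i
    agree i i≢a i≢b = cong is-just (sym (rewired-other i≢a i≢b))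

  unmatch : (M : Matching G) → ∀ {a b} → partner M a ≡ just b →
    Σ (Matching G) λ M′ → covered M ≡ covered M′ + 2 × partner M′ a ≡ nothing × partner M′ b ≡ nothing ×
                          (∀ c → c ≢ a → c ≢ b → partner M′ c ≡ partner M c)
  unmatch M {a} {b} ab = M′ , covered-+2 M′ M a≢b agree (cong is-just rewired-a) (cong is-just (rewired-b a≢b))
                                          (cong is-just ab) (cong is-just (partner-sym M ab))
                            , rewired-a , rewired-b a≢b , λ c → rewired-other
    where
    open Rewire M a b nothing nothing
    a≢b : a ≢ b
    a≢b = adjacent⇒≢ G (partner-adj M ab)
    sym′ : ∀ {c d} → rewired c ≡ just d → rewired d ≡ just c
    sym′ {c} {d} cd with c ≟ a | c ≟ b
    ... | no c≢a | no c≢b = trans (rewired-other d≢a d≢b) (partner-sym M cd)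
      where
      d≢a : d ≢ a
      d≢a refl = c≢b (just-injective (trans (sym (partner-sym M cd)) ab))
      d≢b : d ≢ b
      d≢b refl = c≢a (partner-unique M cd ab)
    adj′ : ∀ {c d} → rewired c ≡ just d → Adjacent G c d
    adj′ {c} cd with c ≟ a | c ≟ b
    ... | no _ | no _ = partner-adj M cd
    M′ : Matching G
    M′ = record { partner = rewired ; partner-sym = sym′ ; partner-adj = adj′ }
    agree : ∀ i → i ≢ a → i ≢ b → matched M′ i ≡ matched M i
    agree i i≢a i≢b = cong is-just (rewired-other i≢a i≢b)

  asList : ∀ k (M : Matching G) → covered M ≡ k →
    Σ (List (Fin n × Fin n)) λ L → IsMatching G L × covered M ≡ 2 * length L ×
                                   (∀ {x} → x ∈ endpoints L → matched M x ≡ true)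
  asList zero M covered≡0 = [] , record { edges = All.[] ; disjoint = AllPairs.[] } , covered≡0 , λ ()
  asList (suc k) M covered≡k with 1≤count⇒member (matched M) (≤-trans (s≤s z≤n) (≤-reflexive (sym covered≡k)))
  ... | a , a-matched with partner M a in ab
  ... | just b with unmatch M ab
  ... | M′ , covered≡ , a-free , b-free , elsewhere with k | trans (sym covered≡k) covered≡
  ...   | zero   | 1≡ = contradiction (trans 1≡ (+-comm (covered M′) 2)) λ ()
  ...   | suc k′ | k≡ with asList k′ M′ (+-cancelʳ-≡ 2 _ _ (trans (sym k≡) (+-comm 2 k′)))
  ...     | L , record { edges = edges ; disjoint = disjoint } , covered′≡ , matched′ =
    (a , b) ∷ L , record { edges = partner-adj M ab All.∷ edges ; disjoint = a-fresh AllPairs.∷ b-fresh AllPairs.∷ disjoint }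
    , trans covered≡ (trans (cong (_+ 2) covered′≡) (trans (+-comm _ 2) (sym (*-suc 2 (length L)))))
    , matched-endpoint
    where
    free⇒fresh : ∀ {c} → partner M′ c ≡ nothing → All (c ≢_) (endpoints L)
    free⇒fresh c-free = All.tabulate (λ { x∈ refl → contradiction (trans (sym (cong is-just c-free)) (matched′ x∈)) λ () })
    a-fresh : All (a ≢_) (b ∷ endpoints L)
    a-fresh = adjacent⇒≢ G (partner-adj M ab) All.∷ free⇒fresh a-free
    b-fresh : All (b ≢_) (endpoints L)
    b-fresh = free⇒fresh b-free
    matched-endpoint : ∀ {x} → x ∈ endpoints ((a , b) ∷ L) → matched M x ≡ true
    matched-endpoint (here refl)         = cong is-just ab
    matched-endpoint (there (here refl)) = cong is-just (partner-sym M ab)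
    matched-endpoint {x} (there (there x∈)) = trans (cong is-just (sym (elsewhere x x≢a x≢b))) (matched′ x∈)
      where
      x≢a : x ≢ a
      x≢a refl = contradiction (trans (sym (cong is-just a-free)) (matched′ x∈)) λ ()
      x≢b : x ≢ b
      x≢b refl = contradiction (trans (sym (cong is-just b-free)) (matched′ x∈)) λ ()

  covered-even : ∀ (M : Matching G) → ∃ λ k → covered M ≡ 2 * k
  covered-even M with asList (covered M) M refl
  ... | L , _ , covered≡ , _ = length L , covered≡

  covered≤2*matchingNumber : ∀ {ν} → IsMatchingNumber G ν → ∀ (M : Matching G) → covered M ≤ 2 * ν
  covered≤2*matchingNumber isν M with asList (covered M) M refl
  ... | L , L-matching , covered≡ , _ = ≤-trans (≤-reflexive covered≡) (*-monoʳ-≤ 2 (IsMatchingNumber.maximal isν L L-matching))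

  module _ (P Q : Matching G) {K : Fin n → Set} (K? : Decidable K)
           (P-closed : ∀ {a b} → K a → partner P a ≡ just b → K b)
           (Q-closed : ∀ {a b} → K a → partner Q a ≡ just b → K b) where

    private
      spliced : Fin n → Maybe (Fin n)
      spliced a with K? a
      ... | yes _ = partner P a
      ... | no _  = partner Q a

      spliced-sym : ∀ {a b} → spliced a ≡ just b → spliced b ≡ just a
      spliced-sym {a} {b} ab with K? a | K? b
      ... | yes _  | yes _  = partner-sym P ab
      ... | yes Ka | no ¬Kb = contradiction (P-closed Ka ab) ¬Kb
      ... | no ¬Ka | yes Kb = contradiction (Q-closed Kb (partner-sym Q ab)) ¬Ka
      ... | no _   | no _   = partner-sym Q ab

      spliced-adj : ∀ {a b} → spliced a ≡ just b → Adjacent G a b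
      spliced-adj {a} ab with K? a
      ... | yes _ = partner-adj P ab
      ... | no _  = partner-adj Q ab

    splice : Matching G
    splice = record { partner = spliced ; partner-sym = spliced-sym ; partner-adj = spliced-adj }

    splice-inside : ∀ {a} → K a → partner splice a ≡ partner P a
    splice-inside {a} Ka with K? a
    ... | yes _  = refl
    ... | no ¬Ka = contradiction Ka ¬Ka

    splice-outside : ∀ {a} → ¬ K a → partner splice a ≡ partner Q a
    splice-outside {a} ¬Ka with K? a
    ... | yes Ka = contradiction Ka ¬Ka
    ... | no _   = refl

    matched-splice : ∀ {a} → (K a → matched P a ≡ matched Q a) → matched splice a ≡ matched Q a
    matched-splice {a} P≡Q with K? a
    ... | yes Ka = P≡Q Ka
    ... | no _   = refl

  ∅ : Matching G
  ∅ = record { partner = λ _ → nothing ; partner-sym = λ () ; partner-adj = λ () }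

  ¬¬-maximum : ¬ ¬ (Σ (Matching G) IsMaximum)
  ¬¬-maximum = ascend n (∅ , λ M′ → ≤-trans (count≤n (matched M′)) (m≤n+m n _))
    where
    ascend : ∀ t → (Σ (Matching G) λ M → ∀ M′ → covered M′ ≤ covered M + t) → ¬ ¬ (Σ (Matching G) IsMaximum)
    ascend zero    (M , bounded) = pure (M , λ M′ → ≤-trans (bounded M′) (≤-reflexive (+-identityʳ _)))
    ascend (suc t) (M , bounded) = do
      larger? ← ¬¬-excluded-middle {A = Σ (Matching G) λ M″ → covered M < covered M″}
      case larger? of λ where
        (yes (M″ , M<M″)) →
          ascend t (M″ , λ M′ → ≤-trans (bounded M′) (≤-trans (≤-reflexive (+-suc _ t)) (+-monoˡ-≤ t M<M″)))
        (no  none)        → pure (M , λ M′ → ≮⇒≥ (λ M<M′ → none (M′ , M<M′)))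

module _ {n} {G : Graph n} {L : Fin n → Bool} where

  lift : Matching (induced G L) → Matching G
  lift M = record
    { partner = partner M ; partner-sym = partner-sym M ; partner-adj = proj₁ ∘ induced-adjacent⇒ G L ∘ partner-adj M }

  partner-inside : ∀ (M : Matching (induced G L)) {a b} → partner M a ≡ just b → L a ≡ true × L b ≡ true
  partner-inside M ab = proj₂ (induced-adjacent⇒ G L (partner-adj M ab))

  outside-free : ∀ (M : Matching (induced G L)) {a} → L a ≡ false → partner M a ≡ nothing
  outside-free M {a} La with partner M a in ab
  ... | nothing = refl
  ... | just _  = contradiction (trans (sym (proj₁ (partner-inside M ab))) La) λ ()

module _ {n} {G : Graph n} (C : Fin n → Bool) (M₁ : Matching (induced G C)) (M₂ : Matching (induced G (not ∘ C))) where

  private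
    M₁-closed : ∀ {a b} → C a ≡ true → partner M₁ a ≡ just b → C b ≡ true
    M₁-closed _ ab = proj₂ (partner-inside M₁ ab)
    M₂-closed : ∀ {a b} → C a ≡ true → partner M₂ a ≡ just b → C b ≡ true
    M₂-closed Ca ab = contradiction (trans (sym (proj₁ (partner-inside M₂ ab))) (cong not Ca)) λ ()

    inside? : Decidable (λ a → C a ≡ true)
    inside? a = C a ≟ᵇ true

  union : Matching G
  union = splice (lift M₁) (lift M₂) inside? M₁-closed M₂-closed

  covered-union : covered union ≡ covered M₁ + covered M₂
  covered-union = trans (sum-cong-≗ pointwise) (∑-distrib-+ (𝟙 ∘ matched M₁) (𝟙 ∘ matched M₂))
    where
    pointwise : ∀ a → 𝟙 (matched union a) ≡ 𝟙 (matched M₁ a) + 𝟙 (matched M₂ a)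
    pointwise a = by-side (C a) refl
      where
      by-side : ∀ c → C a ≡ c → 𝟙 (matched union a) ≡ 𝟙 (matched M₁ a) + 𝟙 (matched M₂ a)
      by-side true  Ca = trans (cong (𝟙 ∘ is-just) (splice-inside (lift M₁) (lift M₂) inside? M₁-closed M₂-closed Ca))
        (sym (trans (cong (λ m → 𝟙 (matched M₁ a) + 𝟙 (is-just m)) (outside-free M₂ (cong not Ca))) (+-identityʳ _)))
      by-side false Ca = trans (cong (𝟙 ∘ is-just)
          (splice-outside (lift M₁) (lift M₂) inside? M₁-closed M₂-closed λ Ca′ → contradiction (trans (sym Ca) Ca′) λ ()))
        (cong (λ m → 𝟙 (is-just m) + 𝟙 (matched M₂ a)) (sym (outside-free M₁ Ca)))

-- Alternating walks

isEven : ℕ → Bool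
isEven zero    = true
isEven (suc i) = not (isEven i)

not≢⇒≡ : ∀ {b β} → not b ≢ β → b ≡ β
not≢⇒≡ {false} {false} _ = refl
not≢⇒≡ {false} {true}  ≠ = contradiction refl ≠
not≢⇒≡ {true}  {false} ≠ = contradiction refl ≠
not≢⇒≡ {true}  {true}  _ = refl

isEven-+-even : ∀ j i → isEven j ≡ true → isEven (j + i) ≡ isEven i
isEven-+-odd  : ∀ j i → isEven j ≡ false → isEven (j + i) ≡ not (isEven i)
isEven-+-even zero    i _ = refl
isEven-+-even (suc j) i e = trans (cong not (isEven-+-odd j i (not-injective {y = false} e))) (not-involutive (isEven i))
isEven-+-odd  (suc j) i e = cong not (isEven-+-even j i (not-injective {y = true} e))

EndCases : ∀ {n} {G : Graph n} → Matching G → Matching G → Fin n → Fin n → Set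
EndCases M N x y = (partner M y ≡ nothing × matched N y ≡ true × y ≢ x) ⊎ (partner N y ≡ nothing × matched M y ≡ true)

record AlternatingPath {n} {G : Graph n} (M N : Matching G) (x : Fin n) : Set₁ where
  field
    K        : Fin n → Set
    K?       : Decidable K
    y        : Fin n
    x∈K      : K x
    y∈K      : K y
    M-closed : ∀ {a b} → K a → partner M a ≡ just b → K b
    N-closed : ∀ {a b} → K a → partner N a ≡ just b → K b
    interior : ∀ {a} → K a → a ≢ x → a ≢ y → matched M a ≡ true × matched N a ≡ true
    ends     : EndCases M N x y

module AlternatingWalk {n} {G : Graph n} (M N : Matching G) (x : Fin n)
  (x-M-free : partner M x ≡ nothing) (x-N-matched : matched N x ≡ true) where

  side : Bool → Matching G
  side true  = N
  side false = M

  turn : ℕ → Matching G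
  turn i = side (isEven i)

  position : ℕ → Maybe (Fin n)
  position zero    = just x
  position (suc i) = position i Maybe.>>= partner (turn i)

  step : ∀ i {a b} → position i ≡ just a → partner (turn i) a ≡ just b → position (suc i) ≡ just b
  step i pa ab rewrite pa = ab

  previous : ∀ i {b} → position (suc i) ≡ just b → ∃[ a ] position i ≡ just a × partner (turn i) a ≡ just b
  previous i e with position i
  ... | just a = a , refl , e

  on-side : ∀ i {β a b} → isEven i ≡ β → partner (turn i) a ≡ just b → partner (side β) a ≡ just b
  on-side i {a = a} {b} e = subst (λ β → partner (side β) a ≡ just b) e

  -- Compare the steps around two visits of a. If they are an even number of steps apart, both
  -- visits are entered through the same matching, so the previous vertices agree as well, and
  -- at the start the walk would re-enter x through M. If they are an odd number apart, leaving
  -- the first visit and entering the second use the same matching, so the gap shrinks by two.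
  no-return : ∀ j i {a} → position i ≡ just a → position (suc (j + i)) ≡ just a → ⊥
  no-return j i pa pa′ with isEven j in j-parity
  no-return j zero refl pa′ | false with previous (j + 0) pa′
  ... | c , _ , cx = contradiction (trans (sym x-M-free) (partner-sym M (on-side (j + 0) (isEven-+-odd j 0 j-parity) cx))) λ ()
  no-return j (suc i) pa pa′ | false with previous i pa | previous (j + suc i) pa′
  ... | c , pc , ca | d , pd , da =
    no-return j i pc (trans (cong position (sym (+-suc j i))) (subst (λ t → position (j + suc i) ≡ just t) d≡c pd))
    where
    d≡c : d ≡ c
    d≡c = partner-unique (turn i) (on-side (j + suc i) (trans (isEven-+-odd j (suc i) j-parity) (not-involutive (isEven i))) da) ca
  no-return zero i pa pa′ | true with previous i pa′
  ... | c , pc , ca rewrite just-injective (trans (sym pa) pc) = partner≢self (turn i) ca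
  no-return (suc (suc j)) i pa pa′ | true with previous (suc (suc (j + i))) pa′
  ... | d , pd , da = no-return j (suc i) (step i pa ad) (trans (cong (position ∘ suc) (+-suc j i)) pd)
    where
    ad : partner (turn i) _ ≡ just d
    ad = partner-sym (turn i) (on-side (suc (suc (j + i)))
      (trans (not-involutive _) (isEven-+-even j i (trans (sym (not-involutive (isEven j))) j-parity))) da)

  defined-below : ∀ {i k b} → i ≤ k → position k ≡ just b → ∃ λ a → position i ≡ just a
  defined-below {k = k} {b} i≤k pk with m≤n⇒m<n∨m≡n i≤k
  ... | inj₂ refl = b , pk
  defined-below {k = suc k} i≤k pk | inj₁ (s≤s i≤k′) with previous k pk
  ... | c , pc , _ = defined-below i≤k′ pc

  Ends : Set
  Ends = ∃₂ λ ℓ y → position ℓ ≡ just y × partner (turn ℓ) y ≡ nothing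

  endless⇒defined : ¬ Ends → ∀ i → ∃ λ a → position i ≡ just a
  endless⇒defined endless zero = x , refl
  endless⇒defined endless (suc i) with endless⇒defined endless i
  ... | a , pa with partner (turn i) a in ab
  ...   | nothing = contradiction (i , a , pa , ab) endless
  ...   | just b  = b , step i pa ab

  ¬¬-ends : ¬ ¬ Ends
  ¬¬-ends endless = no-repetition (pigeonhole (n<1+n n) (proj₁ ∘ defined ∘ toℕ))
    where
    defined : ∀ i → ∃ λ a → position i ≡ just a
    defined = endless⇒defined endless
    no-repetition : ∃₂ (λ k₁ k₂ → k₁ Data.Fin.< k₂ × proj₁ (defined (toℕ k₁)) ≡ proj₁ (defined (toℕ k₂))) → ⊥
    no-repetition (k₁ , k₂ , k₁<k₂ , same) with m≤n⇒∃[o]m+o≡n k₁<k₂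
    ... | j , k₁+j≡k₂ = no-return j (toℕ k₁) (proj₂ (defined (toℕ k₁)))
          (subst (λ k → position k ≡ just _) (trans (sym k₁+j≡k₂) (cong suc (+-comm (toℕ k₁) j)))
                 (trans (proj₂ (defined (toℕ k₂))) (cong just (sym same))))

  endpoint-cases : ∀ ℓ {y} → position ℓ ≡ just y → partner (turn ℓ) y ≡ nothing → EndCases M N x y
  endpoint-cases zero refl N-stops = contradiction (trans (sym x-N-matched) (cong is-just N-stops)) λ ()
  endpoint-cases (suc ℓ) {y} pℓ stops with isEven ℓ | previous ℓ pℓ
  ... | false | c , _ , cy = inj₂ (stops , cong is-just (partner-sym M cy))
  ... | true  | c , _ , cy = inj₁ (stops , cong is-just (partner-sym N cy) , y≢x)
    where
    y≢x : y ≢ x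
    y≢x refl = no-return ℓ 0 refl (trans (cong (position ∘ suc) (+-identityʳ ℓ)) pℓ)

  module _ (ℓ : ℕ) (y : Fin n) (reaches-y : position ℓ ≡ just y) (stops : partner (turn ℓ) y ≡ nothing) where

    OnWalk : Fin n → Set
    OnWalk a = ∃ λ i → i < suc ℓ × position i ≡ just a

    onWalk? : Decidable OnWalk
    onWalk? a = anyUpTo? (λ i → ≡-dec-Maybe _≟_ (position i) (just a)) (suc ℓ)

    closed : ∀ β {a b} → OnWalk a → partner (side β) a ≡ just b → OnWalk b
    closed β {a} {b} (i , i≤ℓ , pa) ab with isEven i ≟ᵇ β
    ... | yes refl with m≤n⇒m<n∨m≡n (≤-pred i≤ℓ)
    ...   | inj₁ i<ℓ  = suc i , s≤s i<ℓ , step i pa ab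
    ...   | inj₂ refl = contradiction
      (trans (sym stops) (subst (λ c → partner (turn i) c ≡ just b) (just-injective (trans (sym pa) reaches-y)) ab)) λ ()
    closed false {b = b} (zero , _ , refl) ab | no _ = contradiction (trans (sym x-M-free) ab) λ ()
    closed true (zero , _ , refl) ab | no ≠ = contradiction refl ≠
    closed β {a} {b} (suc i , i≤ℓ , pa) ab | no ≠ with previous i pa
    ... | c , pc , ca = i , ≤-trans (n≤1+n _) i≤ℓ ,
      subst (λ d → position i ≡ just d) (just-injective (trans (sym (partner-sym (side β) ca′)) ab)) pc
      where
      ca′ : partner (side β) c ≡ just a
      ca′ = on-side i (not≢⇒≡ ≠) ca

    both-sides : ∀ β {a} → matched (side β) a ≡ true → matched (side (not β)) a ≡ true →
      matched M a ≡ true × matched N a ≡ true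
    both-sides true  Na Ma = Ma , Na
    both-sides false Ma Na = Ma , Na

    interior : ∀ {a} → OnWalk a → a ≢ x → a ≢ y → matched M a ≡ true × matched N a ≡ true
    interior (zero , _ , refl) a≢x _ = contradiction refl a≢x
    interior (suc i , i<ℓ+1 , pa) _ a≢y with m≤n⇒m<n∨m≡n (≤-pred i<ℓ+1)
    ... | inj₂ refl = contradiction (just-injective (trans (sym pa) reaches-y)) a≢y
    ... | inj₁ i<ℓ with previous i pa | defined-below i<ℓ reaches-y
    ...   | c , _ , ca | d , pd with previous (suc i) pd
    ...     | a′ , pa′ , a′d rewrite just-injective (trans (sym pa′) pa) =
      both-sides (isEven i) (cong is-just (partner-sym (turn i) ca)) (cong is-just a′d)

    path : AlternatingPath M N x
    path = record
      { K = OnWalk ; K? = onWalk? ; y = y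
      ; x∈K = 0 , s≤s z≤n , refl ; y∈K = ℓ , ≤-refl , reaches-y
      ; M-closed = closed false ; N-closed = closed true
      ; interior = interior ; ends = endpoint-cases ℓ reaches-y stops }

  ¬¬-alternatingPath : ¬ ¬ AlternatingPath M N x
  ¬¬-alternatingPath no-path = ¬¬-ends λ { (ℓ , y , reaches-y , stops) → no-path (path ℓ y reaches-y stops) }

-- Gallai's lemma

module Switching {n} {G : Graph n} {M N : Matching G} (M-max : IsMaximum M) (N-max : IsMaximum N)
  {x} (x-M-free : partner M x ≡ nothing) (x-N-matched : matched N x ≡ true) (path : AlternatingPath M N x) where

  open AlternatingPath path

  N-inside M-inside : Matching G
  N-inside = splice N M K? N-closed M-closed
  M-inside = splice M N K? M-closed N-closed

  N-inside-in : ∀ {a} → K a → partner N-inside a ≡ partner N a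
  N-inside-in = splice-inside N M K? N-closed M-closed

  N-inside-out : ∀ {a} → ¬ K a → partner N-inside a ≡ partner M a
  N-inside-out = splice-outside N M K? N-closed M-closed

  M-inside-in : ∀ {a} → K a → partner M-inside a ≡ partner M a
  M-inside-in = splice-inside M N K? M-closed N-closed

  M-inside-out : ∀ {a} → ¬ K a → partner M-inside a ≡ partner N a
  M-inside-out = splice-outside M N K? M-closed N-closed

  private
    agree-inside : ∀ {i} → i ≢ x → i ≢ y → K i → matched N i ≡ matched M i
    agree-inside i≢x i≢y Ki = let M-i , N-i = interior Ki i≢x i≢y in trans N-i (sym M-i)

  outside : ∀ {a} → a ≢ x → a ≢ y → partner M a ≡ nothing ⊎ partner N a ≡ nothing → ¬ K a
  outside a≢x a≢y (inj₁ M-free) Ka = contradiction (trans (sym (proj₁ (interior Ka a≢x a≢y))) (cong is-just M-free)) λ ()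
  outside a≢x a≢y (inj₂ N-free) Ka = contradiction (trans (sym (proj₂ (interior Ka a≢x a≢y))) (cong is-just N-free)) λ ()

  no-M-free-end : ¬ (partner M y ≡ nothing × matched N y ≡ true × y ≢ x)
  no-M-free-end (y-M-free , y-N-matched , y≢x) = m+1+n≰m (covered M) (subst (_≤ covered M) grows (M-max N-inside))
    where
    grows : covered N-inside ≡ covered M + 2
    grows = covered-+2 M N-inside (y≢x ∘ sym)
      (λ i i≢x i≢y → sym (matched-splice N M K? N-closed M-closed (agree-inside i≢x i≢y)))
      (cong is-just x-M-free) (cong is-just y-M-free)
      (trans (cong is-just (N-inside-in x∈K)) x-N-matched)
      (trans (cong is-just (N-inside-in y∈K)) y-N-matched)

  module _ (y-N-free : partner N y ≡ nothing) (y-M-matched : matched M y ≡ true) where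

    x≢y : x ≢ y
    x≢y refl = contradiction (trans (sym x-N-matched) (cong is-just y-N-free)) λ ()

    N-inside-maximum : IsMaximum N-inside
    N-inside-maximum M′ = ≤-trans (M-max M′) (≤-reflexive (covered-exchange M N-inside x≢y
      (λ i i≢x i≢y → sym (matched-splice N M K? N-closed M-closed (agree-inside i≢x i≢y)))
      (cong is-just x-M-free) y-M-matched
      (trans (cong is-just (N-inside-in x∈K)) x-N-matched)
      (cong is-just (trans (N-inside-in y∈K) y-N-free))))

    M-inside-maximum : IsMaximum M-inside
    M-inside-maximum M′ = ≤-trans (N-max M′) (≤-reflexive (sym (covered-exchange M-inside N x≢y
      (λ i i≢x i≢y → matched-splice M N K? M-closed N-closed (sym ∘ agree-inside i≢x i≢y))
      (cong is-just (trans (M-inside-in x∈K) x-M-free))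
      (trans (cong is-just (M-inside-in y∈K)) y-M-matched)
      x-N-matched (cong is-just y-N-free))))

Connected : ∀ {n} → Graph n → Fin n → Fin n → Set
Connected G = Star (Adjacent G)

Avoidable : ∀ {n} → Graph n → Fin n → Set
Avoidable G w = Σ (Matching _) λ N → IsMaximum {G = G} N × partner N w ≡ nothing

module _ {n} {G : Graph n} where

  maximum-unaugmentable : ∀ (M : Matching G) → IsMaximum M → ∀ {a b} →
    partner M a ≡ nothing → partner M b ≡ nothing → ¬ Adjacent G a b
  maximum-unaugmentable M M-max a-free b-free ab with augment M a-free b-free ab
  ... | M′ , covered≡ = m+1+n≰m (covered M) (subst (_≤ covered M) covered≡ (M-max M′))

  -- Induction along a path x w ⋯ z: take a maximum matching N missing w and switch along the
  -- alternating path from x. Either a maximum matching grows, or the switched matching is a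
  -- maximum matching missing w and z, or one missing the adjacent x and w.
  free-vertices-disconnected : (∀ {w} → 1 ≤ degree G w → ¬ ¬ Avoidable G w) →
    ∀ (M : Matching G) → IsMaximum M → ∀ {x z} → x ≢ z →
    partner M x ≡ nothing → partner M z ≡ nothing → ¬ Connected G x z
  free-vertices-disconnected avoidable M M-max x≢z _ _ ε = x≢z refl
  free-vertices-disconnected avoidable M M-max {x} {z} x≢z x-free z-free (_◅_ {j = w} xw w⋯z) with w ≟ z
  ... | yes refl = maximum-unaugmentable M M-max x-free z-free xw
  ... | no w≢z   = avoidable (adjacent⇒1≤degree G (adjacent-sym G xw)) λ (N , N-max , w-free) → via N N-max w-free
    where
    via : ∀ (N : Matching G) → IsMaximum N → partner N w ≡ nothing → ⊥
    via N N-max w-free with partner N x in Nx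
    ... | nothing = maximum-unaugmentable N N-max Nx w-free xw
    ... | just _  = AlternatingWalk.¬¬-alternatingPath M N x x-free (cong is-just Nx) λ path → switch path (AlternatingPath.ends path)
      where
      switch : (path : AlternatingPath M N x) → EndCases M N x (AlternatingPath.y path) → ⊥
      switch path (inj₁ M-free-end) = Switching.no-M-free-end M-max N-max x-free (cong is-just Nx) path M-free-end
      switch path (inj₂ (y-N-free , y-M-matched)) = by-cases (y ≟ w)
        where
        open AlternatingPath path
        open Switching M-max N-max x-free (cong is-just Nx) path
        by-cases : Dec (y ≡ w) → ⊥
        by-cases (yes y≡w) = free-vertices-disconnected avoidable N-inside (N-inside-maximum y-N-free y-M-matched) w≢z
          (trans (cong (partner N-inside) (sym y≡w)) (trans (N-inside-in y∈K) y-N-free))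
          (trans (N-inside-out z∉K) z-free) w⋯z
          where
          z∉K : ¬ K z
          z∉K = outside (x≢z ∘ sym) (λ { refl → contradiction (trans (sym y-M-matched) (cong is-just z-free)) λ () }) (inj₁ z-free)
        by-cases (no y≢w) = maximum-unaugmentable M-inside (M-inside-maximum y-N-free y-M-matched)
          (trans (M-inside-in x∈K) x-free)
          (trans (M-inside-out w∉K) w-free) xw
          where
          w∉K : ¬ K w
          w∉K = outside (adjacent⇒≢ G xw ∘ sym) (y≢w ∘ sym) (inj₂ w-free)

component-closed : ∀ {n} {G : Graph n} {u} (C? : Decidable (Connected G u)) →
  ∀ {a b} → Adjacent G a b → does (C? a) ≡ does (C? b)
component-closed {G = G} C? ab = does-⇔ (mk⇔ (λ ua → ua ◅◅ (ab ◅ ε)) (λ ub → ub ◅◅ (adjacent-sym G ab ◅ ε))) (C? _) (C? _)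

-- Edges against matchings and maximum degree

counting-bound : ∀ E s D c → E ≤ s * D → E ≤ s * pred s → s ≤ suc c → E ≤ c * suc D
counting-bound E s D c E≤sD E≤ss s≤c+1 with D ≤? c
... | yes D≤c = begin
  E               ≤⟨ E≤sD ⟩
  s * D           ≤⟨ *-monoˡ-≤ D s≤c+1 ⟩
  D + c * D       ≤⟨ +-monoˡ-≤ (c * D) D≤c ⟩
  c + c * D       ≡⟨ *-suc c D ⟨
  c * suc D       ∎
  where open ≤-Reasoning
... | no D≰c = begin
  E               ≤⟨ E≤ss ⟩
  s * pred s      ≤⟨ *-mono-≤ s≤c+1 (pred-mono-≤ s≤c+1) ⟩
  suc c * c       ≡⟨ *-comm (suc c) c ⟩
  c * suc c       ≤⟨ *-monoʳ-≤ c (s≤s (<⇒≤ (≰⇒> D≰c))) ⟩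
  c * suc D       ∎
  where open ≤-Reasoning

even-<⇒+2≤ : ∀ a b → 2 * a < 2 * b → 2 * a + 2 ≤ 2 * b
even-<⇒+2≤ a b 2a<2b =
  ≤-trans (≤-reflexive (trans (+-comm (2 * a) 2) (sym (*-suc 2 a)))) (*-monoʳ-≤ 2 (*-cancelˡ-< 2 a b 2a<2b))

Essential : ∀ {n} → Graph n → Fin n → Set
Essential G v = ∀ (M : Matching G) → IsMaximum M → matched M v ≡ true

module _ (D : ℕ) {n : ℕ} where

  MaxDegree≤D : Graph n → Set
  MaxDegree≤D G = ∀ v → degree G v ≤ D

  DegreeSumBound : Graph n → Set
  DegreeSumBound G = ∀ (M : Matching G) → IsMaximum M → ¬ ¬ (degreeSum G ≤ covered M * suc D)

  BoundForSmaller : Graph n → Set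
  BoundForSmaller G = ∀ (G′ : Graph n) → degreeSum G′ < degreeSum G → MaxDegree≤D G′ → DegreeSumBound G′

  bound-deleting-essential : ∀ (G : Graph n) → BoundForSmaller G → MaxDegree≤D G →
    ∀ v → 1 ≤ degree G v → Essential G v → DegreeSumBound G
  bound-deleting-essential G smaller Δ≤D v 1≤dv v-essential M M-max = do
    (M′ , M′-max) ← ¬¬-maximum
    bound′ ← smaller (G ─ v) (degreeSum-─-< G v 1≤dv)
                     (λ a → ≤-trans (degree-induced-≤ G (except v) a) (Δ≤D a)) M′ M′-max
    pure (begin
      degreeSum G                          ≤⟨ degreeSum-─ G v ⟩
      degreeSum (G ─ v) + 2 * degree G v   ≤⟨ +-mono-≤ bound′ (*-monoʳ-≤ 2 (m≤n⇒m≤1+n (Δ≤D v))) ⟩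
      covered M′ * suc D + 2 * suc D       ≡⟨ *-distribʳ-+ (suc D) (covered M′) 2 ⟨
      (covered M′ + 2) * suc D             ≤⟨ *-monoˡ-≤ (suc D) (shrinks M′) ⟩
      covered M * suc D                    ∎)
    where
    open ≤-Reasoning
    shrinks : ∀ (M′ : Matching (G ─ v)) → covered M′ + 2 ≤ covered M
    shrinks M′ with covered-even M′ | covered-even M | m≤n⇒m<n∨m≡n (M-max (lift M′))
    ... | a , ca | b , cb | inj₁ lt =
      subst₂ (λ s t → s + 2 ≤ t) (sym ca) (sym cb) (even-<⇒+2≤ a b (subst₂ _<_ ca cb lt))
    ... | _ | _ | inj₂ same = contradiction (v-essential (lift M′) (λ M″ → ≤-trans (M-max M″) (≤-reflexive (sym same))))
      (λ matched-v → contradiction (trans (sym matched-v) (cong is-just (outside-free M′ (except-self v)))) λ ())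

  bound-splitting : ∀ (G : Graph n) → BoundForSmaller G → MaxDegree≤D G → ∀ (C : Fin n → Bool) →
    (∀ {a b} → Adjacent G a b → C a ≡ C b) →
    (∃₂ λ a b → Adjacent G a b × C a ≡ true) → (∃₂ λ a b → Adjacent G a b × C a ≡ false) → DegreeSumBound G
  bound-splitting G smaller Δ≤D C closed (a₁ , b₁ , a₁b₁ , Ca₁) (a₂ , b₂ , a₂b₂ , Ca₂) M M-max = do
    (M₁ , M₁-max) ← ¬¬-maximum
    (M₂ , M₂-max) ← ¬¬-maximum
    bound₁ ← smaller G₁ (part₁<whole) (λ a → ≤-trans (degree-induced-≤ G C a) (Δ≤D a)) M₁ M₁-max
    bound₂ ← smaller G₂ (part₂<whole) (λ a → ≤-trans (degree-induced-≤ G (not ∘ C) a) (Δ≤D a)) M₂ M₂-max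
    pure (begin
      degreeSum G                                      ≡⟨ split ⟩
      degreeSum G₁ + degreeSum G₂                      ≤⟨ +-mono-≤ bound₁ bound₂ ⟩
      covered M₁ * suc D + covered M₂ * suc D          ≡⟨ *-distribʳ-+ (suc D) (covered M₁) (covered M₂) ⟨
      (covered M₁ + covered M₂) * suc D                ≡⟨ cong (_* suc D) (covered-union C M₁ M₂) ⟨
      covered (union C M₁ M₂) * suc D                  ≤⟨ *-monoˡ-≤ (suc D) (M-max (union C M₁ M₂)) ⟩
      covered M * suc D                                ∎)
    where
    open ≤-Reasoning
    G₁ G₂ : Graph n
    G₁ = induced G C
    G₂ = induced G (not ∘ C)
    split : degreeSum G ≡ degreeSum G₁ + degreeSum G₂
    split = degreeSum-split G C closed
    1≤part₁ : 1 ≤ degreeSum G₁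
    1≤part₁ = ≤-trans (adjacent⇒1≤degree G₁ (adjacent⇒induced G C a₁b₁ Ca₁ (trans (sym (closed a₁b₁)) Ca₁)))
                      (term≤∑ (degree G₁) a₁)
    1≤part₂ : 1 ≤ degreeSum G₂
    1≤part₂ = ≤-trans (adjacent⇒1≤degree G₂ (adjacent⇒induced G (not ∘ C) a₂b₂ (cong not Ca₂)
                                              (cong not (trans (sym (closed a₂b₂)) Ca₂))))
                      (term≤∑ (degree G₂) a₂)
    part₁<whole : degreeSum G₁ < degreeSum G
    part₁<whole = subst (degreeSum G₁ <_) (sym split) (m<m+n (degreeSum G₁) 1≤part₂)
    part₂<whole : degreeSum G₂ < degreeSum G
    part₂<whole = subst (degreeSum G₂ <_) (sym split) (m<n+m (degreeSum G₂) 1≤part₁)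

  freeNonIsolated : ∀ {G : Graph n} → Matching G → Fin n → Bool
  freeNonIsolated {G} M a = nonIsolated G a ∧ not (matched M a)

  nonIsolated≤covered+free : ∀ {G : Graph n} (M : Matching G) →
    count (nonIsolated G) ≤ covered M + count (freeNonIsolated M)
  nonIsolated≤covered+free {G} M = ≤-trans (∑-mono-≤ (λ a → pointwise (nonIsolated G a) (matched M a)))
                                           (≤-reflexive (∑-distrib-+ (𝟙 ∘ matched M) (𝟙 ∘ freeNonIsolated M)))
    where
    pointwise : ∀ x y → 𝟙 x ≤ 𝟙 y + 𝟙 (x ∧ not y)
    pointwise false _     = z≤n
    pointwise true  true  = ≤-refl
    pointwise true  false = ≤-refl

  inessential⇒avoidable : ∀ {G : Graph n} → ¬ (∃ λ v → 1 ≤ degree G v × Essential G v) →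
    ∀ {w} → 1 ≤ degree G w → ¬ ¬ Avoidable G w
  inessential⇒avoidable none {w} 1≤dw unavoidable = none (w , 1≤dw , essential)
    where
    essential : Essential _ w
    essential N N-max with partner N w in Nw
    ... | nothing = contradiction (N , N-max , Nw) unavoidable
    ... | just _  = refl

  bound-no-essential : ∀ (G : Graph n) → BoundForSmaller G → MaxDegree≤D G →
    (∀ {w} → 1 ≤ degree G w → ¬ ¬ Avoidable G w) → DegreeSumBound G
  bound-no-essential G smaller Δ≤D avoidable M M-max with count (freeNonIsolated M) ≤? 1
  ... | yes F≤1 = pure (counting-bound (degreeSum G) s D (covered M)
                         (degreeSum≤nonIsolated* G D (λ a _ → Δ≤D a))
                         (degreeSum≤nonIsolated* G (pred s) (λ a 1≤d → <⇒≤pred (degree<nonIsolated G a 1≤d)))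
                         (≤-trans (nonIsolated≤covered+free M)
                                  (≤-trans (+-monoʳ-≤ (covered M) F≤1) (≤-reflexive (+-comm (covered M) 1)))))
    where
    s : ℕ
    s = count (nonIsolated G)
  ... | no F≰1 with 2≤count⇒two-members (freeNonIsolated M) (≰⇒> F≰1)
  ...   | u , v , u≢v , u-free , v-free = do
    C? ← ¬¬-decidable (Connected G u)
    bound-splitting G smaller Δ≤D (does ∘ C?) (component-closed {G = G} C?)
      (edge-at u-free (dec-true (C? u) ε))
      (edge-at v-free (dec-false (C? v) (free-vertices-disconnected avoidable M M-max u≢v (free u-free) (free v-free))))
      M M-max
    where
    free : ∀ {a} → freeNonIsolated M a ≡ true → partner M a ≡ nothing
    free e = unmatched⇒free M (not-injective {y = false} (proj₂ (∧-true e)))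
    edge-at : ∀ {a c} {C : Fin n → Bool} → freeNonIsolated M a ≡ true → C a ≡ c →
      ∃₂ λ a′ b → Adjacent G a′ b × C a′ ≡ c
    edge-at {a} e Ca = let b , ab = 1≤count⇒member (adj G a) (does⇒witness (1 ≤? degree G a) (proj₁ (∧-true e)))
                       in a , b , ab , Ca

  degreeSum≤covered*suc : ∀ (G : Graph n) → MaxDegree≤D G → DegreeSumBound G
  degreeSum≤covered*suc G =
    <-rec (λ s → ∀ G → degreeSum G ≡ s → MaxDegree≤D G → DegreeSumBound G) step (degreeSum G) G refl
    where
    step : ∀ s → (∀ {s′} → s′ < s → ∀ G → degreeSum G ≡ s′ → MaxDegree≤D G → DegreeSumBound G) →
      ∀ G → degreeSum G ≡ s → MaxDegree≤D G → DegreeSumBound G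
    step _ rec G refl Δ≤D M M-max = do
      essential? ← ¬¬-excluded-middle {A = ∃ λ v → 1 ≤ degree G v × Essential G v}
      case essential? of λ where
        (yes (v , 1≤dv , v-essential)) → bound-deleting-essential G smaller Δ≤D v 1≤dv v-essential M M-max
        (no none)                      → bound-no-essential G smaller Δ≤D (inessential⇒avoidable none) M M-max
      where
      smaller : BoundForSmaller G
      smaller G′ lt = rec lt G′ refl

degreeSum≤2*ν*suc : ∀ {n} (G : Graph n) D ν → (∀ v → degree G v ≤ D) → (∀ (M : Matching G) → covered M ≤ 2 * ν) →
  degreeSum G ≤ 2 * ν * suc D
degreeSum≤2*ν*suc G D ν Δ≤D covered≤ = decidable-stable (degreeSum G ≤? 2 * ν * suc D) do
  (M , M-max) ← ¬¬-maximum
  bound-M ← degreeSum≤covered*suc D G Δ≤D M M-max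
  pure (≤-trans bound-M (*-monoˡ-≤ (suc D) (covered≤ M)))

listSum-allFin : ∀ {n} (f : Fin n → ℕ) → List.sum (map f (allFin n)) ≡ ∑[ i < n ] f i
listSum-allFin {n} f = trans (cong List.sum (map-tabulate (λ i → i) f)) (listSum-tabulate f)
  where
  listSum-tabulate : ∀ {m} (g : Fin m → ℕ) → List.sum (tabulate g) ≡ ∑[ i < m ] g i
  listSum-tabulate {zero}  g = refl
  listSum-tabulate {suc m} g = cong (g zero +_) (listSum-tabulate (g ∘ suc))

deg≡degree : ∀ {n} (G : Graph n) v → deg G v ≡ degree G v
deg≡degree G v = listSum-allFin (𝟙 ∘ adj G v)

2*numEdges≤degreeSum : ∀ {n} (G : Graph n) → 2 * numEdges G ≤ degreeSum G
2*numEdges≤degreeSum {n} G = begin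
  2 * numEdges G                                              ≡⟨ cong (2 *_) numEdges≡ ⟩
  2 * E                                                       ≡⟨ cong (E +_) (+-identityʳ E) ⟩
  E + E                                                       ≡⟨ cong (E +_) E≡backward ⟩
  E + ∑[ i < n ] count (backward i)                           ≡⟨ ∑-distrib-+ (count ∘ forward) (count ∘ backward) ⟨
  ∑[ i < n ] (count (forward i) + count (backward i))
    ≡⟨ sum-cong-≗ (λ i → ∑-distrib-+ (𝟙 ∘ forward i) (𝟙 ∘ backward i)) ⟨
  ∑[ i < n ] ∑[ j < n ] (𝟙 (forward i j) + 𝟙 (backward i j))  ≤⟨ ∑-mono-≤ (λ i → ∑-mono-≤ (λ j → pointwise i j)) ⟩
  degreeSum G                                                 ∎
  where
  open ≤-Reasoning
  forward backward : Fin n → Fin n → Bool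
  forward  i j = adj G i j ∧ (toℕ i <ᵇ toℕ j)
  backward i j = adj G i j ∧ (toℕ j <ᵇ toℕ i)
  E : ℕ
  E = ∑[ i < n ] count (forward i)
  numEdges≡ : numEdges G ≡ E
  numEdges≡ = trans (listSum-allFin (λ i → countFin (forward i))) (sum-cong-≗ (λ i → listSum-allFin (𝟙 ∘ forward i)))
  E≡backward : E ≡ ∑[ i < n ] count (backward i)
  E≡backward = trans (∑-comm (λ i j → 𝟙 (forward i j)))
    (sum-cong-≗ (λ j → sum-cong-≗ (λ i → cong (λ t → 𝟙 (t ∧ (toℕ i <ᵇ toℕ j))) (Graph.sym G i j))))
  pointwise : ∀ i j → 𝟙 (forward i j) + 𝟙 (backward i j) ≤ 𝟙 (adj G i j)
  pointwise i j with adj G i j | toℕ i <ᵇ toℕ j in i<j | toℕ j <ᵇ toℕ i in j<i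
  ... | false | _     | _     = z≤n
  ... | true  | true  | true  = contradiction (<ᵇ⇒< (toℕ i) (toℕ j) (true⇒T i<j)) (<⇒≯ (<ᵇ⇒< (toℕ j) (toℕ i) (true⇒T j<i)))
  ... | true  | true  | false = ≤-refl
  ... | true  | false | b     = 𝟙≤1 b

listSum-mono-∈ : ∀ (f : ℕ → ℕ) {x xs} → x ∈ xs → f x ≤ List.sum (map f xs)
listSum-mono-∈ f (here refl) = m≤m+n _ _
listSum-mono-∈ f (there x∈) = ≤-trans (listSum-mono-∈ f x∈) (m≤n+m _ _)

listSum-∑-comm : ∀ {n} (F : ℕ → Fin n → ℕ) xs →
  List.sum (map (λ i → ∑[ a < n ] F i a) xs) ≡ ∑[ a < n ] List.sum (map (λ i → F i a) xs)
listSum-∑-comm {n} F []       = sym (∑-zero {n} (λ _ → refl))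
listSum-∑-comm     F (x ∷ xs) = trans (cong (sum (F x) +_) (listSum-∑-comm F xs)) (sym (∑-distrib-+ (F x) _))

lowDegree : ∀ {n} → Graph n → ℕ → Fin n → Bool
lowDegree G q a = not (q ≤ᵇ degree G a)

degree-lowDegree≤ : ∀ {n} (G : Graph n) D v → degree (induced G (lowDegree G (suc D))) v ≤ D
degree-lowDegree≤ G D v = by-side (lowDegree G (suc D) v) refl
  where
  by-side : ∀ b → lowDegree G (suc D) v ≡ b → degree (induced G (lowDegree G (suc D))) v ≤ D
  by-side true  low = ≤-trans (degree-induced-≤ G (lowDegree G (suc D)) v)
    (≮⇒≥ (λ D<d → contradiction (trans (sym (not-involutive _)) (cong not low)) (λ ≤ᵇ≡false → subst T ≤ᵇ≡false (≤⇒≤ᵇ D<d))))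
  by-side false high = ≤-trans (≤-reflexive (degree-induced-outside G (lowDegree G (suc D)) high)) z≤n

degreeSumOutside≤highDegSum : ∀ {n} (G : Graph n) q → degreeSumOutside G (lowDegree G q) ≤ highDegSum G q
degreeSumOutside≤highDegSum {n} G q = begin
  degreeSumOutside G (lowDegree G q)                           ≡⟨ sum-cong-≗ (λ a → outside≡high (degree G a)) ⟩
  ∑[ a < n ] high (degree G a)                                 ≡⟨ sum-cong-≗ (λ a → diagonal (degree G a)) ⟨
  ∑[ a < n ] term a (degree G a)                               ≤⟨ ∑-mono-≤ (λ a → listSum-mono-∈ (term a) (∈-upTo⁺ (degree<n G a))) ⟩
  ∑[ a < n ] List.sum (map (λ i → term a i) (upTo n))          ≡⟨ listSum-∑-comm (λ i a → term a i) (upTo n) ⟨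
  List.sum (map (λ i → ∑[ a < n ] term a i) (upTo n))          ≡⟨ cong List.sum (map-cong regroup (upTo n)) ⟩
  highDegSum G q                                               ∎
  where
  open ≤-Reasoning
  high : ℕ → ℕ
  high i = if q ≤ᵇ i then i else 0
  term : Fin n → ℕ → ℕ
  term a i = 𝟙 (degree G a ≡ᵇ i) * high i
  diagonal : ∀ d → 𝟙 (d ≡ᵇ d) * high d ≡ high d
  diagonal d rewrite T⇒≡true (≡⇒≡ᵇ d d refl) = +-identityʳ (high d)
  outside≡high : ∀ d → 𝟙 (not (not (q ≤ᵇ d))) * d ≡ high d
  outside≡high d rewrite not-involutive (q ≤ᵇ d) with q ≤ᵇ d
  ... | true  = +-identityʳ d
  ... | false = refl
  regroup : ∀ i → ∑[ a < n ] term a i ≡ (if q ≤ᵇ i then i * D G i else 0)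
  regroup i = begin-equality
    ∑[ a < n ] term a i                          ≡⟨ *-distribʳ-sum (high i) (λ a → 𝟙 (degree G a ≡ᵇ i)) ⟨
    count (λ a → degree G a ≡ᵇ i) * high i       ≡⟨ cong (_* high i) D≡count ⟨
    D G i * high i                               ≡⟨ by-threshold (q ≤ᵇ i) ⟩
    (if q ≤ᵇ i then i * D G i else 0)            ∎
    where
    D≡count : D G i ≡ count (λ a → degree G a ≡ᵇ i)
    D≡count = trans (listSum-allFin (λ a → 𝟙 (deg G a ≡ᵇ i)))
                    (sum-cong-≗ (λ a → cong (λ d → 𝟙 (d ≡ᵇ i)) (deg≡degree G a)))
    by-threshold : ∀ b → D G i * (if b then i else 0) ≡ (if b then i * D G i else 0)
    by-threshold true  = *-comm (D G i) i
    by-threshold false = *-zeroʳ (D G i)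

mainTheorem5 : ∀ (n : ℕ) (G : Graph n) (ν : ℕ) → IsMatchingNumber G ν →
    ∀ (q : ℕ) → 1 ≤ q → q < n →
      numEdges G ≤ q * ν + highDegSum G q
mainTheorem5 n G ν isν (suc D) _ _ = *-cancelˡ-≤ 2 (begin
  2 * numEdges G                               ≤⟨ 2*numEdges≤degreeSum G ⟩
  degreeSum G                                  ≤⟨ degreeSum-induced G L ⟩
  degreeSum H + 2 * degreeSumOutside G L       ≤⟨ +-mono-≤ low-part high-part ⟩
  2 * ν * suc D + 2 * highDegSum G (suc D)     ≡⟨ regroup ν D (highDegSum G (suc D)) ⟩
  2 * (suc D * ν + highDegSum G (suc D))       ∎)
  where
  open ≤-Reasoning
  L : Fin n → Bool
  L = lowDegree G (suc D)
  H : Graph n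
  H = induced G L
  low-part : degreeSum H ≤ 2 * ν * suc D
  low-part = degreeSum≤2*ν*suc H D ν (degree-lowDegree≤ G D) (λ M → covered≤2*matchingNumber isν (lift M))
  high-part : 2 * degreeSumOutside G L ≤ 2 * highDegSum G (suc D)
  high-part = *-monoʳ-≤ 2 (degreeSumOutside≤highDegSum G (suc D))
  regroup : ∀ ν D h → 2 * ν * suc D + 2 * h ≡ 2 * (suc D * ν + h)
  regroup = solve 3 (λ ν D h → con 2 :* ν :* (con 1 :+ D) :+ con 2 :* h := con 2 :* ((con 1 :+ D) :* ν :+ h)) refl
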